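{- Let $G$ be a $(2K_2, K_5-e)$-free graph. Then $\chi(G) \leq \omega(G)+4$.
   Context: All graphs are finite, simple and undirected. $2K_2$ is the disjoint union of two edges; $K_5-e$ is the complete graph on $5$ vertices minus one edge. A graph is $\mathcal{F}$-free if it has no induced subgraph isomorphic to a member of $\mathcal{F}$. $\chi$ is the chromatic number and $\omega$ the clique number. -}

module Defs where

open import Data.Nat using (ℕ; zero; suc; _+_; _≤_)
open import Data.Fin using (Fin; zero; suc; toℕ)
open import Data.Fin.Properties using () renaming (_≟_ to _≟F_)
open import Data.Bool using (Bool; true; false; not; _∧_; _∨_)
open import Data.Product using (Σ; ∃; _×_; _,_)
open import Data.List using (List; []; _∷_)
open import Data.List.Relation.Unary.Any using (Any)
open import Data.Sum using (_⊎_)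
open import Relation.Binary.PropositionalEquality using (_≡_; _≢_)
open import Relation.Nullary using (¬_; does)
open import Function.Definitions using (Injective)

record Graph : Set where
  field
    n      : ℕ
    adj    : Fin n → Fin n → Bool
    sym    : ∀ u v → adj u v ≡ adj v u
    irrefl : ∀ v → adj v v ≡ false

open Graph public

InducedSubgraph : Graph → Graph → Set
InducedSubgraph H G =
  Σ (Fin (n H) → Fin (n G)) λ f →
    Injective _≡_ _≡_ f × (∀ u v → adj G (f u) (f v) ≡ adj H u v)

Free : List Graph → Graph → Set
Free F G = ∀ {H} → Any (H ≡_) F → ¬ InducedSubgraph H G

adj2K2 : Fin 4 → Fin 4 → Bool
adj2K2 zero (suc zero) = true
adj2K2 (suc zero) zero = true
adj2K2 (suc (suc zero)) (suc (suc (suc zero))) = true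
adj2K2 (suc (suc (suc zero))) (suc (suc zero)) = true
adj2K2 _ _ = false

twoK2 : Graph
twoK2 = record { n = 4 ; adj = adj2K2 ; sym = s ; irrefl = i }
  where
  s : ∀ u v → adj2K2 u v ≡ adj2K2 v u
  s zero zero = _≡_.refl
  s zero (suc zero) = _≡_.refl
  s zero (suc (suc zero)) = _≡_.refl
  s zero (suc (suc (suc zero))) = _≡_.refl
  s (suc zero) zero = _≡_.refl
  s (suc zero) (suc zero) = _≡_.refl
  s (suc zero) (suc (suc zero)) = _≡_.refl
  s (suc zero) (suc (suc (suc zero))) = _≡_.refl
  s (suc (suc zero)) zero = _≡_.refl
  s (suc (suc zero)) (suc zero) = _≡_.refl
  s (suc (suc zero)) (suc (suc zero)) = _≡_.refl
  s (suc (suc zero)) (suc (suc (suc zero))) = _≡_.refl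
  s (suc (suc (suc zero))) zero = _≡_.refl
  s (suc (suc (suc zero))) (suc zero) = _≡_.refl
  s (suc (suc (suc zero))) (suc (suc zero)) = _≡_.refl
  s (suc (suc (suc zero))) (suc (suc (suc zero))) = _≡_.refl
  i : ∀ v → adj2K2 v v ≡ false
  i zero = _≡_.refl
  i (suc zero) = _≡_.refl
  i (suc (suc zero)) = _≡_.refl
  i (suc (suc (suc zero))) = _≡_.refl

isZero : ∀ {k} → Fin k → Bool
isZero zero = true
isZero (suc _) = false

isOne : ∀ {k} → Fin k → Bool
isOne (suc zero) = true
isOne _ = false

adjK5e : Fin 5 → Fin 5 → Bool
adjK5e u v =
  not (does (u ≟F v)) ∧ not ((isZero u ∧ isOne v) ∨ (isOne u ∧ isZero v))

K5-e : Graph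
K5-e = record { n = 5 ; adj = adjK5e ; sym = s ; irrefl = i }
  where
  s : ∀ u v → adjK5e u v ≡ adjK5e v u
  s zero zero = _≡_.refl
  s zero (suc zero) = _≡_.refl
  s zero (suc (suc zero)) = _≡_.refl
  s zero (suc (suc (suc zero))) = _≡_.refl
  s zero (suc (suc (suc (suc zero)))) = _≡_.refl
  s (suc zero) zero = _≡_.refl
  s (suc zero) (suc zero) = _≡_.refl
  s (suc zero) (suc (suc zero)) = _≡_.refl
  s (suc zero) (suc (suc (suc zero))) = _≡_.refl
  s (suc zero) (suc (suc (suc (suc zero)))) = _≡_.refl
  s (suc (suc zero)) zero = _≡_.refl
  s (suc (suc zero)) (suc zero) = _≡_.refl
  s (suc (suc zero)) (suc (suc zero)) = _≡_.refl
  s (suc (suc zero)) (suc (suc (suc zero))) = _≡_.refl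
  s (suc (suc zero)) (suc (suc (suc (suc zero)))) = _≡_.refl
  s (suc (suc (suc zero))) zero = _≡_.refl
  s (suc (suc (suc zero))) (suc zero) = _≡_.refl
  s (suc (suc (suc zero))) (suc (suc zero)) = _≡_.refl
  s (suc (suc (suc zero))) (suc (suc (suc zero))) = _≡_.refl
  s (suc (suc (suc zero))) (suc (suc (suc (suc zero)))) = _≡_.refl
  s (suc (suc (suc (suc zero)))) zero = _≡_.refl
  s (suc (suc (suc (suc zero)))) (suc zero) = _≡_.refl
  s (suc (suc (suc (suc zero)))) (suc (suc zero)) = _≡_.refl
  s (suc (suc (suc (suc zero)))) (suc (suc (suc zero))) = _≡_.refl
  s (suc (suc (suc (suc zero)))) (suc (suc (suc (suc zero)))) = _≡_.refl
  i : ∀ v → adjK5e v v ≡ false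
  i zero = _≡_.refl
  i (suc zero) = _≡_.refl
  i (suc (suc zero)) = _≡_.refl
  i (suc (suc (suc zero))) = _≡_.refl
  i (suc (suc (suc (suc zero)))) = _≡_.refl

HasClique : Graph → ℕ → Set
HasClique G k =
  Σ (Fin k → Fin (n G)) λ f →
    Injective _≡_ _≡_ f × (∀ i j → i ≢ j → adj G (f i) (f j) ≡ true)

Colourable : Graph → ℕ → Set
Colourable G k =
  Σ (Fin (n G) → Fin k) λ c → ∀ u v → adj G u v ≡ true → c u ≢ c v

IsCliqueNumber : Graph → ℕ → Set
IsCliqueNumber G w = HasClique G w × (∀ k → HasClique G k → k ≤ w)

IsChromaticNumber : Graph → ℕ → Set
IsChromaticNumber G c = Colourable G c × (∀ k → Colourable G k → c ≤ k)

-- Fix a maximum clique K = {K₀, …, K_{ω-1}}; every vertex outside K misses some Kᵢ.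
-- Two kinds of sets are independent: the vertices missing two fixed Kᵢ, Kⱼ (an edge
-- among them and the edge KᵢKⱼ form a 2K₂), and the vertices adjacent to every Kⱼ
-- except Kᵢ (the ends of an edge among them together with K − Kᵢ form an
-- (ω+1)-clique); the latter also miss Kᵢ, so they share its colour.  For ω ≤ 3 these
-- classes give at most ω + 3 colours.  For ω ≥ 4 an outside vertex x adjacent to three
-- of K₀, …, K₃ would form a K₅ − e with them and a Kⱼ it misses, so x misses two of
-- K₀, …, K₃; the six pairs give six independent classes, four of which merge with the
-- colours of K₀, …, K₃.
module Submission where

open import Defs
open import Data.Nat using (ℕ; suc; _+_; _≤_)
open import Data.Nat.Properties using (1+n≰n; m≤m+n; +-monoʳ-≤)
open import Data.Fin using (Fin; suc; join; splitAt; inject≤)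
open import Data.Fin.Patterns using (0F; 1F; 2F; 3F; 4F)
open import Data.Fin.Properties using (any?; splitAt-join; inject≤-injective; _≟_)
open import Data.Vec.Functional using (updateAt) renaming ([] to []ᵥ; _∷_ to _∷ᵥ_)
open import Data.Vec.Functional.Properties using (updateAt-updates; updateAt-minimal)
open import Data.Bool using (true; false)
import Data.Bool.Properties as Bool
open import Data.Product using (Σ; ∃; _×_; _,_; proj₁; proj₂; curry)
open import Data.Sum using (_⊎_; inj₁; inj₂)
open import Data.Empty using (⊥; ⊥-elim)
open import Data.List using ([]; _∷_)
open import Data.List.Relation.Unary.Any using (here; there)
open import Function using (_∘_; const)
open import Function.Definitions using (Injective)
open import Relation.Binary.PropositionalEquality
  using (_≡_; _≢_; refl; cong; subst; trans) renaming (sym to ≡-sym)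
open import Relation.Nullary using (¬_; Dec; yes; no)

private
  true≢false : true ≢ false
  true≢false ()

∷ᵥ-injective : ∀ {A : Set} {k} {x : A} {f : Fin k → A} →
               (∀ i → x ≢ f i) → Injective _≡_ _≡_ f →
               Injective _≡_ _≡_ (x ∷ᵥ f)
∷ᵥ-injective x∉f f-inj {0F}    {0F}    _ = refl
∷ᵥ-injective x∉f f-inj {0F}    {suc j} e = ⊥-elim (x∉f j e)
∷ᵥ-injective x∉f f-inj {suc i} {0F}    e = ⊥-elim (x∉f i (≡-sym e))
∷ᵥ-injective x∉f f-inj {suc i} {suc j} e = cong suc (f-inj e)

[]ᵥ-injective : ∀ {A : Set} → Injective _≡_ _≡_ ([]ᵥ {A = A})
[]ᵥ-injective {x = ()}

IsClique : (G : Graph) {k : ℕ} → (Fin k → Fin (n G)) → Set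
IsClique G f = ∀ i j → i ≢ j → adj G (f i) (f j) ≡ true

IsMaximumClique : (G : Graph) {w : ℕ} → (Fin w → Fin (n G)) → Set
IsMaximumClique G {w} K = IsClique G K × (∀ k → HasClique G k → k ≤ w)

module GraphLemmas (G : Graph) where

  adj-flip : ∀ {u v b} → adj G u v ≡ b → adj G v u ≡ b
  adj-flip {u} {v} e = trans (sym G v u) e

  adj⇒≢ : ∀ {u v} → adj G u v ≡ true → u ≢ v
  adj⇒≢ {u} e refl = true≢false (trans (≡-sym e) (irrefl G u))

  adj-nonadj⇒≢ : ∀ {u v z} → adj G u v ≡ true → adj G v z ≡ false → u ≢ z
  adj-nonadj⇒≢ e h refl = true≢false (trans (≡-sym e) (adj-flip h))

  clique-injective : ∀ {k} {f : Fin k → Fin (n G)} → IsClique G f → Injective _≡_ _≡_ f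
  clique-injective {f = f} f-clique {i} {j} e with i ≟ j
  ... | yes i≡j = i≡j
  ... | no  i≢j = ⊥-elim (adj⇒≢ (f-clique i j i≢j) e)

  clique⇒hasClique : ∀ {k} {f : Fin k → Fin (n G)} → IsClique G f → HasClique G k
  clique⇒hasClique {f = f} f-clique = f , clique-injective f-clique , f-clique

  clique-∘ : ∀ {k l} {f : Fin k → Fin (n G)} {g : Fin l → Fin k} →
             IsClique G f → Injective _≡_ _≡_ g → IsClique G (f ∘ g)
  clique-∘ f-clique g-injective i j i≢j = f-clique _ _ (i≢j ∘ g-injective)

  extend-clique : ∀ {k x} {f : Fin k → Fin (n G)} → IsClique G f →
                  (∀ j → adj G x (f j) ≡ true) → IsClique G (x ∷ᵥ f)
  extend-clique f-clique x-f 0F      0F      ne = ⊥-elim (ne refl)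
  extend-clique f-clique x-f 0F      (suc j) _  = x-f j
  extend-clique f-clique x-f (suc i) 0F      _  = adj-flip (x-f i)
  extend-clique f-clique x-f (suc i) (suc j) ne = f-clique i j (ne ∘ cong suc)

  updateAt-cases : ∀ {k} {A : Set} (f : Fin k → A) (i : Fin k) (u : A) j →
                   (j ≡ i × updateAt f i (const u) j ≡ u) ⊎
                   (j ≢ i × updateAt f i (const u) j ≡ f j)
  updateAt-cases f i u j with j ≟ i
  ... | yes refl = inj₁ (refl , updateAt-updates i f)
  ... | no  j≢i  = inj₂ (j≢i , updateAt-minimal j i f j≢i)

  replace-in-clique : ∀ {k u} {f : Fin k → Fin (n G)} (i : Fin k) → IsClique G f →
                      (∀ j → j ≢ i → adj G u (f j) ≡ true) →
                      IsClique G (updateAt f i (const u))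
  replace-in-clique {u = u} {f} i f-clique u-f a b a≢b
    with updateAt-cases f i u a | updateAt-cases f i u b
  ... | inj₁ (refl , _)  | inj₁ (refl , _)  = ⊥-elim (a≢b refl)
  ... | inj₁ (refl , ea) | inj₂ (b≢i , eb)  rewrite ea | eb = u-f b b≢i
  ... | inj₂ (a≢i , ea)  | inj₁ (refl , eb) rewrite ea | eb = adj-flip (u-f a a≢i)
  ... | inj₂ (_ , ea)    | inj₂ (_ , eb)    rewrite ea | eb = f-clique a b a≢b

  adjacent-to-replaced : ∀ {k u v} {f : Fin k → Fin (n G)} (i : Fin k) →
                         adj G v u ≡ true → (∀ j → j ≢ i → adj G v (f j) ≡ true) →
                         ∀ j → adj G v (updateAt f i (const u) j) ≡ true
  adjacent-to-replaced {u = u} {f = f} i v-u v-f j with updateAt-cases f i u j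
  ... | inj₁ (_ , e)   rewrite e = v-u
  ... | inj₂ (j≢i , e) rewrite e = v-f j j≢i

  2K₂-induced : ∀ {u v p q} → adj G u v ≡ true → adj G p q ≡ true →
                adj G u p ≡ false → adj G u q ≡ false →
                adj G v p ≡ false → adj G v q ≡ false → InducedSubgraph twoK2 G
  2K₂-induced {u} {v} {p} {q} uv pq up uq vp vq = f , f-injective , f-adj
    where
    f : Fin 4 → Fin (n G)
    f = u ∷ᵥ v ∷ᵥ p ∷ᵥ q ∷ᵥ []ᵥ
    f-injective : Injective _≡_ _≡_ f
    f-injective =
      ∷ᵥ-injective
        (λ { 0F → adj⇒≢ uv ; 1F → adj-nonadj⇒≢ uv vp ; 2F → adj-nonadj⇒≢ uv vq })
      (∷ᵥ-injective
        (λ { 0F → adj-nonadj⇒≢ (adj-flip uv) up ; 1F → adj-nonadj⇒≢ (adj-flip uv) uq })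
      (∷ᵥ-injective (λ { 0F → adj⇒≢ pq })
      (∷ᵥ-injective (λ ()) []ᵥ-injective)))
    f-adj : ∀ a b → adj G (f a) (f b) ≡ adj twoK2 a b
    f-adj 0F 0F = irrefl G u
    f-adj 0F 1F = uv
    f-adj 0F 2F = up
    f-adj 0F 3F = uq
    f-adj 1F 0F = adj-flip uv
    f-adj 1F 1F = irrefl G v
    f-adj 1F 2F = vp
    f-adj 1F 3F = vq
    f-adj 2F 0F = adj-flip up
    f-adj 2F 1F = adj-flip vp
    f-adj 2F 2F = irrefl G p
    f-adj 2F 3F = pq
    f-adj 3F 0F = adj-flip uq
    f-adj 3F 1F = adj-flip vq
    f-adj 3F 2F = adj-flip pq
    f-adj 3F 3F = irrefl G q

  K5-e-induced : ∀ {x y} {t : Fin 3 → Fin (n G)} → x ≢ y → adj G x y ≡ false →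
                 IsClique G (x ∷ᵥ t) → IsClique G (y ∷ᵥ t) → InducedSubgraph K5-e G
  K5-e-induced {x} {y} {t} x≢y xy xt yt = f , f-injective , f-adj
    where
    f : Fin 5 → Fin (n G)
    f = x ∷ᵥ y ∷ᵥ t
    f-injective : Injective _≡_ _≡_ f
    f-injective =
      ∷ᵥ-injective (λ { 0F → x≢y ; (suc i) → adj⇒≢ (xt 0F (suc i) λ ()) })
        (clique-injective yt)
    f-adj : ∀ a b → adj G (f a) (f b) ≡ adjK5e a b
    f-adj 0F 0F = irrefl G x
    f-adj 0F 1F = xy
    f-adj 0F 2F = xt 0F 1F λ ()
    f-adj 0F 3F = xt 0F 2F λ ()
    f-adj 0F 4F = xt 0F 3F λ ()
    f-adj 1F 0F = adj-flip xy
    f-adj 1F 1F = irrefl G y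
    f-adj 1F 2F = yt 0F 1F λ ()
    f-adj 1F 3F = yt 0F 2F λ ()
    f-adj 1F 4F = yt 0F 3F λ ()
    f-adj 2F 0F = xt 1F 0F λ ()
    f-adj 2F 1F = yt 1F 0F λ ()
    f-adj 2F 2F = irrefl G (t 0F)
    f-adj 2F 3F = xt 1F 2F λ ()
    f-adj 2F 4F = xt 1F 3F λ ()
    f-adj 3F 0F = xt 2F 0F λ ()
    f-adj 3F 1F = yt 2F 0F λ ()
    f-adj 3F 2F = xt 2F 1F λ ()
    f-adj 3F 3F = irrefl G (t 1F)
    f-adj 3F 4F = xt 2F 3F λ ()
    f-adj 4F 0F = xt 3F 0F λ ()
    f-adj 4F 1F = yt 3F 0F λ ()
    f-adj 4F 2F = xt 3F 1F λ ()
    f-adj 4F 3F = xt 3F 2F λ ()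
    f-adj 4F 4F = irrefl G (t 2F)

  colourable-⊎ : ∀ {a b} (c : Fin (n G) → Fin a ⊎ Fin b) →
                 (∀ u v → adj G u v ≡ true → c u ≢ c v) → Colourable G (a + b)
  colourable-⊎ {a} {b} c proper =
    join a b ∘ c , λ u v uv e → proper u v uv (join-injective e)
    where
    join-injective : Injective _≡_ _≡_ (join a b)
    join-injective {x} {y} e =
      trans (≡-sym (splitAt-join a b x)) (trans (cong (splitAt a) e) (splitAt-join a b y))

  colourable-≤ : ∀ {a b} → Colourable G a → a ≤ b → Colourable G b
  colourable-≤ (c , proper) a≤b =
    (λ x → inject≤ (c x) a≤b) ,
    λ u v uv e → proper u v uv (inject≤-injective a≤b a≤b _ _ e)

data Kind (w : ℕ) : Set where
  misses-pair : (i j : Fin w) → i ≢ j → Kind w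
  misses-only : Fin w → Kind w

first : ∀ {w} → Kind w → Fin w
first (misses-pair i _ _) = i
first (misses-only i)     = i

module MaximumClique (G : Graph) {w : ℕ} (K : Fin w → Fin (n G))
                     (K-maximum : IsMaximumClique G K) where
  open GraphLemmas G

  K-clique : IsClique G K
  K-clique = proj₁ K-maximum

  Hits Misses : Fin (n G) → Fin w → Set
  Hits   x i = adj G x (K i) ≡ true
  Misses x i = adj G x (K i) ≡ false

  HasKind : Fin (n G) → Kind w → Set
  HasKind x (misses-pair i j _) = Misses x i × Misses x j
  HasKind x (misses-only i)     = Misses x i × (∀ j → j ≢ i → Hits x j)

  misses-first : ∀ {x} κ → HasKind x κ → Misses x (first κ)
  misses-first (misses-pair _ _ _) = proj₁
  misses-first (misses-only _)     = proj₁

  ¬dominates-clique : ∀ {x} {f : Fin w → Fin (n G)} → IsClique G f →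
                      (∀ j → adj G x (f j) ≡ true) → ⊥
  ¬dominates-clique f-clique x-f =
    1+n≰n (proj₂ K-maximum _ (clique⇒hasClique (extend-clique f-clique x-f)))

  ¬edge-dominating-all-but : ∀ {u v} i → adj G u v ≡ true →
                             (∀ j → j ≢ i → Hits u j) →
                             (∀ j → j ≢ i → Hits v j) → ⊥
  ¬edge-dominating-all-but i uv u-K v-K =
    ¬dominates-clique (replace-in-clique i K-clique u-K)
                      (adjacent-to-replaced i (adj-flip uv) v-K)

  hits-or-misses : ∀ x → (∀ j → Hits x j) ⊎ ∃ (Misses x)
  hits-or-misses x with any? (λ j → adj G x (K j) Bool.≟ false)
  ... | yes miss = inj₂ miss
  ... | no ¬miss = inj₁ hit
    where
    hit : ∀ j → Hits x j
    hit j with adj G x (K j) in e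
    ... | true  = refl
    ... | false = ⊥-elim (¬miss (j , e))

  module _ (no-2K₂ : ¬ InducedSubgraph twoK2 G) where

    kind-independent : ∀ {u v} κ → HasKind u κ → HasKind v κ → adj G u v ≡ true → ⊥
    kind-independent (misses-pair i j i≢j) (ui , uj) (vi , vj) uv =
      no-2K₂ (2K₂-induced uv (K-clique i j i≢j) ui uj vi vj)
    kind-independent (misses-only i) (_ , u-K) (_ , v-K) uv =
      ¬edge-dominating-all-but i uv u-K v-K

    -- Colour inj₁ j is shared by Kⱼ and the outside vertices of kind (kind (inj₁ j)),
    -- which miss Kⱼ by kind-first.
    colourable : ∀ {m} (kind : Fin w ⊎ Fin m → Kind w) →
                 (∀ j → first (kind (inj₁ j)) ≡ j) →
                 (∀ x → (∀ j → x ≢ K j) → Σ (Fin w ⊎ Fin m) (HasKind x ∘ kind)) →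
                 Colourable G (w + m)
    colourable {m} kind kind-first classify =
      colourable-⊎ (λ x → colour x (membership x))
                   (λ u v uv → proper uv (membership u) (membership v))
      where
      membership : ∀ x → Dec (∃ λ j → x ≡ K j)
      membership x = any? (λ j → x ≟ K j)

      colour : ∀ x → Dec (∃ λ j → x ≡ K j) → Fin w ⊎ Fin m
      colour x (yes (j , _)) = inj₁ j
      colour x (no x∉K)      = proj₁ (classify x (curry x∉K))

      outside-kind : ∀ {x} (x∉K : ¬ ∃ λ j → x ≡ K j) →
                     HasKind x (kind (colour x (no x∉K)))
      outside-kind {x} x∉K = proj₂ (classify x (curry x∉K))

      misses-own-colour : ∀ {x} j → HasKind x (kind (inj₁ j)) → Misses x j
      misses-own-colour {x} j h =
        subst (Misses x) (kind-first j) (misses-first (kind (inj₁ j)) h)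

      proper : ∀ {u v} → adj G u v ≡ true → ∀ du dv → colour u du ≢ colour v dv
      proper uv (yes (j , refl)) (yes (.j , refl)) refl = adj⇒≢ uv refl
      proper {v = v} uv (yes (j , refl)) (no v∉K) e =
        true≢false (trans (≡-sym (adj-flip uv))
          (misses-own-colour j (subst (HasKind v ∘ kind) (≡-sym e) (outside-kind v∉K))))
      proper {u = u} uv (no u∉K) (yes (j , refl)) e =
        true≢false (trans (≡-sym uv)
          (misses-own-colour j (subst (HasKind u ∘ kind) e (outside-kind u∉K))))
      proper {v = v} uv (no u∉K) (no v∉K) e =
        kind-independent _ (outside-kind u∉K)
          (subst (HasKind v ∘ kind) (≡-sym e) (outside-kind v∉K)) uv

  module _ (no-K5-e : ¬ InducedSubgraph K5-e G) where

    ¬outside-hits-three : ∀ {x a b c} → (∀ j → x ≢ K j) →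
                          a ≢ b → a ≢ c → b ≢ c →
                          Hits x a → Hits x b → Hits x c → ⊥
    ¬outside-hits-three {x} {a} {b} {c} x∉K a≢b a≢c b≢c xa xb xc with hits-or-misses x
    ... | inj₁ x-K      = ¬dominates-clique K-clique x-K
    ... | inj₂ (d , xd) = no-K5-e (K5-e-induced (x∉K d) xd x-t Kd-t)
      where
      t : Fin 3 → Fin (n G)
      t = K ∘ (a ∷ᵥ b ∷ᵥ c ∷ᵥ []ᵥ)
      t-clique : IsClique G t
      t-clique = clique-∘ K-clique
        (∷ᵥ-injective (λ { 0F → a≢b ; 1F → a≢c })
        (∷ᵥ-injective (λ { 0F → b≢c })
        (∷ᵥ-injective (λ ()) []ᵥ-injective)))
      x-t : IsClique G (x ∷ᵥ t)
      x-t = extend-clique t-clique λ { 0F → xa ; 1F → xb ; 2F → xc }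
      d≢ : ∀ {i} → Hits x i → d ≢ i
      d≢ xi refl = true≢false (trans (≡-sym xi) xd)
      Kd-t : IsClique G (K d ∷ᵥ t)
      Kd-t = extend-clique t-clique λ { 0F → K-clique d a (d≢ xa)
                                      ; 1F → K-clique d b (d≢ xb)
                                      ; 2F → K-clique d c (d≢ xc) }

module _ (G : Graph) (no-2K₂ : ¬ InducedSubgraph twoK2 G) where
  open GraphLemmas G using (colourable-≤)

  colourable-ω≡0 : (K : Fin 0 → Fin (n G)) → IsMaximumClique G K → Colourable G 0
  colourable-ω≡0 K K-maximum = colourable no-2K₂ kind (λ ()) classify
    where
    open MaximumClique G K K-maximum
    kind : Fin 0 ⊎ Fin 0 → Kind 0
    kind (inj₁ ())
    kind (inj₂ ())
    classify : ∀ x → (∀ j → x ≢ K j) → Σ (Fin 0 ⊎ Fin 0) (HasKind x ∘ kind)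
    classify x _ = ⊥-elim (¬dominates-clique {x = x} K-clique λ ())

  colourable-ω≡1 : (K : Fin 1 → Fin (n G)) → IsMaximumClique G K → Colourable G 1
  colourable-ω≡1 K K-maximum = colourable no-2K₂ kind (λ _ → refl) classify
    where
    open MaximumClique G K K-maximum
    kind : Fin 1 ⊎ Fin 0 → Kind 1
    kind (inj₁ i)  = misses-only i
    kind (inj₂ ())
    classify : ∀ x → (∀ j → x ≢ K j) → Σ (Fin 1 ⊎ Fin 0) (HasKind x ∘ kind)
    classify x _ with adj G x (K 0F) in e0
    ... | false = inj₁ 0F , e0 , λ { 0F ne → ⊥-elim (ne refl) }
    ... | true  = ⊥-elim (¬dominates-clique K-clique λ { 0F → e0 })

  colourable-ω≡2 : (K : Fin 2 → Fin (n G)) → IsMaximumClique G K → Colourable G 3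
  colourable-ω≡2 K K-maximum = colourable no-2K₂ kind (λ _ → refl) classify
    where
    open MaximumClique G K K-maximum
    kind : Fin 2 ⊎ Fin 1 → Kind 2
    kind (inj₁ i) = misses-only i
    kind (inj₂ _) = misses-pair 0F 1F λ ()
    classify : ∀ x → (∀ j → x ≢ K j) → Σ (Fin 2 ⊎ Fin 1) (HasKind x ∘ kind)
    classify x _ with adj G x (K 0F) in e0 | adj G x (K 1F) in e1
    ... | false | false = inj₂ 0F , e0 , e1
    ... | false | true  = inj₁ 0F , e0 , λ { 0F ne → ⊥-elim (ne refl) ; 1F _ → e1 }
    ... | true  | false = inj₁ 1F , e1 , λ { 0F _ → e0 ; 1F ne → ⊥-elim (ne refl) }
    ... | true  | true  = ⊥-elim (¬dominates-clique K-clique λ { 0F → e0 ; 1F → e1 })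

  colourable-ω≡3 : (K : Fin 3 → Fin (n G)) → IsMaximumClique G K → Colourable G 6
  colourable-ω≡3 K K-maximum = colourable no-2K₂ kind (λ _ → refl) classify
    where
    open MaximumClique G K K-maximum
    kind : Fin 3 ⊎ Fin 3 → Kind 3
    kind (inj₁ i)  = misses-only i
    kind (inj₂ 0F) = misses-pair 0F 1F λ ()
    kind (inj₂ 1F) = misses-pair 0F 2F λ ()
    kind (inj₂ 2F) = misses-pair 1F 2F λ ()
    classify : ∀ x → (∀ j → x ≢ K j) → Σ (Fin 3 ⊎ Fin 3) (HasKind x ∘ kind)
    classify x _ with adj G x (K 0F) in e0 | adj G x (K 1F) in e1 | adj G x (K 2F) in e2
    ... | false | false | _     = inj₂ 0F , e0 , e1
    ... | false | true  | false = inj₂ 1F , e0 , e2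
    ... | true  | false | false = inj₂ 2F , e1 , e2
    ... | false | true  | true  =
      inj₁ 0F , e0 , λ { 0F ne → ⊥-elim (ne refl) ; 1F _ → e1 ; 2F _ → e2 }
    ... | true  | false | true  =
      inj₁ 1F , e1 , λ { 0F _ → e0 ; 1F ne → ⊥-elim (ne refl) ; 2F _ → e2 }
    ... | true  | true  | false =
      inj₁ 2F , e2 , λ { 0F _ → e0 ; 1F _ → e1 ; 2F ne → ⊥-elim (ne refl) }
    ... | true  | true  | true  =
      ⊥-elim (¬dominates-clique K-clique λ { 0F → e0 ; 1F → e1 ; 2F → e2 })

  colourable-ω≥4 : ¬ InducedSubgraph K5-e G → ∀ {k} → let w = 4 + k in
                   (K : Fin w → Fin (n G)) → IsMaximumClique G K → Colourable G (w + 2)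
  colourable-ω≥4 no-K5-e {k} K K-maximum = colourable no-2K₂ kind kind-first classify
    where
    open MaximumClique G K K-maximum
    -- The colours of K₄, K₅, … are used by no outside vertex; their kind is immaterial.
    kind : Fin (4 + k) ⊎ Fin 2 → Kind (4 + k)
    kind (inj₁ 0F) = misses-pair 0F 1F λ ()
    kind (inj₁ 1F) = misses-pair 1F 2F λ ()
    kind (inj₁ 2F) = misses-pair 2F 3F λ ()
    kind (inj₁ 3F) = misses-pair 3F 0F λ ()
    kind (inj₁ i)  = misses-only i
    kind (inj₂ 0F) = misses-pair 0F 2F λ ()
    kind (inj₂ 1F) = misses-pair 1F 3F λ ()
    kind-first : ∀ j → first (kind (inj₁ j)) ≡ j
    kind-first 0F = refl
    kind-first 1F = refl
    kind-first 2F = refl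
    kind-first 3F = refl
    kind-first (suc (suc (suc (suc _)))) = refl
    classify : ∀ x → (∀ j → x ≢ K j) → Σ (Fin (4 + k) ⊎ Fin 2) (HasKind x ∘ kind)
    classify x x∉K with adj G x (K 0F) in e0 | adj G x (K 1F) in e1
                      | adj G x (K 2F) in e2 | adj G x (K 3F) in e3
    ... | false | false | _     | _     = inj₁ 0F , e0 , e1
    ... | true  | false | false | _     = inj₁ 1F , e1 , e2
    ... | true  | true  | false | false = inj₁ 2F , e2 , e3
    ... | false | true  | true  | false = inj₁ 3F , e3 , e0
    ... | false | true  | false | _     = inj₂ 0F , e0 , e2
    ... | true  | false | true  | false = inj₂ 1F , e1 , e3
    ... | true  | true  | true  | _     =
      ⊥-elim (¬outside-hits-three no-K5-e x∉K (λ ()) (λ ()) (λ ()) e0 e1 e2)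
    ... | false | true  | true  | true  =
      ⊥-elim (¬outside-hits-three no-K5-e x∉K (λ ()) (λ ()) (λ ()) e1 e2 e3)
    ... | true  | false | true  | true  =
      ⊥-elim (¬outside-hits-three no-K5-e x∉K (λ ()) (λ ()) (λ ()) e0 e2 e3)
    ... | true  | true  | false | true  =
      ⊥-elim (¬outside-hits-three no-K5-e x∉K (λ ()) (λ ()) (λ ()) e0 e1 e3)

  colourable-ω+4 : ¬ InducedSubgraph K5-e G →
                   ∀ w (K : Fin w → Fin (n G)) → IsMaximumClique G K → Colourable G (w + 4)
  colourable-ω+4 _ 0 K K-maximum = colourable-≤ (colourable-ω≡0 K K-maximum) (m≤m+n 0 4)
  colourable-ω+4 _ 1 K K-maximum = colourable-≤ (colourable-ω≡1 K K-maximum) (m≤m+n 1 4)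
  colourable-ω+4 _ 2 K K-maximum = colourable-≤ (colourable-ω≡2 K K-maximum) (m≤m+n 3 3)
  colourable-ω+4 _ 3 K K-maximum = colourable-≤ (colourable-ω≡3 K K-maximum) (m≤m+n 6 1)
  colourable-ω+4 no-K5-e w@(suc (suc (suc (suc _)))) K K-maximum =
    colourable-≤ (colourable-ω≥4 no-K5-e K K-maximum) (+-monoʳ-≤ w (m≤m+n 2 2))

corollary3p11 : (G : Graph) → Free (twoK2 ∷ K5-e ∷ []) G →
    (w c : ℕ) → IsCliqueNumber G w → IsChromaticNumber G c → c ≤ w + 4
corollary3p11 G free w c ((K , _ , K-clique) , K-maximal) (_ , minimal) =
  minimal (w + 4)
    (colourable-ω+4 G (free (here refl)) (free (there (here refl))) w K (K-clique , K-maximal))
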